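{- For every integer $n \ge 2$, $$D_{n+1} - D_n = D_n - \{h_4(n) - h_2(n)\}.$$
   Context: For a binary sequence $x = (x_1,\dots,x_n) \in \{0,1\}^n$ (1 = heads, 0 = tails) define the score $$S(x) = \sum_{i=1}^{n-1} I[x_i = x_{i+1} = 1] - \sum_{i=1}^{n-1} I[x_i = 1,\ x_{i+1} = 0],$$ i.e. the number of occurrences of a 1 immediately followed by a 1 minus the number of occurrences of a 1 immediately followed by a 0. Let $$D_n = \#\{x \in \{0,1\}^n : S(x) < 0\} - \#\{x \in \{0,1\}^n : S(x) > 0\}.$$ Let $h_2(n)$ be the number of $x \in \{0,1\}^n$ with $x_n = 1$ and $S(x) = 1$, and $h_4(n)$ the number of $x \in \{0,1\}^n$ with $x_n = 1$ and $S(x) = -1$. -}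

module Defs where

open import Data.Bool using (Bool; true; false)
open import Data.Nat using (ℕ; zero; suc)
open import Data.Integer as ℤ using (ℤ; +_; _-_; _<_)
open import Data.Vec using (Vec; []; _∷_; last)
open import Data.List using (List; []; _∷_; map; _++_; filter; length)
open import Relation.Binary.PropositionalEquality using (_≡_)
open import Data.Bool.Properties using () renaming (_≟_ to _≟ᵇ_)
open import Data.Integer.Properties using () renaming (_≟_ to _≟ᶻ_; _<?_ to _<?ᶻ_)
open import Data.Product using (_×_)
open import Relation.Nullary.Decidable using (_×-dec_)

-- All binary sequences of length n (true = heads = 1, false = tails = 0).
allSeqs : (n : ℕ) → List (Vec Bool n)
allSeqs zero = [] ∷ []
allSeqs (suc n) = map (true ∷_) (allSeqs n) ++ map (false ∷_) (allSeqs n)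

pairScore : Bool → Bool → ℤ
pairScore true  true  = + 1
pairScore true  false = ℤ.- (+ 1)
pairScore false _     = + 0

-- S(x) = #{i : x_i = x_{i+1} = 1} - #{i : x_i = 1, x_{i+1} = 0}
S : {n : ℕ} → Vec Bool n → ℤ
S []             = + 0
S (x ∷ [])       = + 0
S (x ∷ y ∷ xs)   = pairScore x y ℤ.+ S (y ∷ xs)

D : ℕ → ℤ
D n = + length (filter (λ x → S x <?ᶻ + 0) (allSeqs n))
    - + length (filter (λ x → + 0 <?ᶻ S x) (allSeqs n))

h2 : ℕ → ℕ
h2 zero    = 0
h2 (suc n) = length (filter (λ x → (last x ≟ᵇ true) ×-dec (S x ≟ᶻ + 1)) (allSeqs (suc n)))

h4 : ℕ → ℕ
h4 zero    = 0
h4 (suc n) = length (filter (λ x → (last x ≟ᵇ true) ×-dec (S x ≟ᶻ ℤ.- (+ 1))) (allSeqs (suc n)))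

{-# OPTIONS --safe #-}
module Submission where

-- Write D n = ∑ₓ σ (S x) with σ = negSignum, and enumerate sequences of
-- length n + 1 as x ∷ʳ b. Appending a bit to a sequence ending in 0 leaves S
-- unchanged; appending to one ending in 1 shifts S by +1 or -1, and
-- σ (s + 1) + σ (s - 1) = 2 σ s + [s = 1] - [s = -1].
-- Hence D (n + 1) = 2 D n + h₂ n - h₄ n, which is the claim rearranged.

open import Defs
open import Level using (Level)
open import Data.Bool using (Bool; true; false; if_then_else_)
open import Data.Bool.Properties using () renaming (_≟_ to _≟ᵇ_)
open import Data.Nat using (ℕ; suc; _≤_)
open import Data.Integer using (ℤ; +_; -[1+_]; _+_; _-_; 0ℤ; 1ℤ; -1ℤ)
open import Data.Integer.Properties using (+-identityˡ; +-identityʳ; +-assoc)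
  renaming (_≟_ to _≟ᶻ_; _<?_ to _<?ᶻ_)
open import Data.Integer.Tactic.RingSolver using (solve-∀)
open import Data.List using (List; []; _∷_; map; _++_; filter; length)
open import Data.Vec using (Vec; []; _∷_; last; _∷ʳ_)
open import Relation.Nullary using (does)
open import Relation.Nullary.Decidable using (_×-dec_)
open import Relation.Unary using (Pred; Decidable)
open import Relation.Binary.PropositionalEquality
  using (_≡_; refl; sym; trans; cong; cong₂; module ≡-Reasoning)

private
  variable
    ℓ : Level
    A B : Set

∑ : List A → (A → ℤ) → ℤ
∑ []       f = 0ℤ
∑ (x ∷ xs) f = f x + ∑ xs f

syntax ∑ xs (λ x → e) = ∑[ x ∈ xs ] e

∑-cong : ∀ (xs : List A) {f g : A → ℤ} → (∀ x → f x ≡ g x) → ∑ xs f ≡ ∑ xs g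
∑-cong []       f≗g = refl
∑-cong (x ∷ xs) f≗g = cong₂ _+_ (f≗g x) (∑-cong xs f≗g)

∑-++ : ∀ (xs ys : List A) (f : A → ℤ) → ∑ (xs ++ ys) f ≡ ∑ xs f + ∑ ys f
∑-++ []       ys f = sym (+-identityˡ _)
∑-++ (x ∷ xs) ys f = trans (cong (_+_ (f x)) (∑-++ xs ys f)) (sym (+-assoc (f x) _ _))

∑-map : ∀ (g : A → B) (xs : List A) (f : B → ℤ) → ∑ (map g xs) f ≡ ∑[ x ∈ xs ] f (g x)
∑-map g []       f = refl
∑-map g (x ∷ xs) f = cong (_+_ (f (g x))) (∑-map g xs f)

∑-distrib-+ : ∀ (xs : List A) (f g : A → ℤ) → ∑[ x ∈ xs ] (f x + g x) ≡ ∑ xs f + ∑ xs g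
∑-distrib-+ []       f g = refl
∑-distrib-+ (x ∷ xs) f g =
  trans (cong (_+_ (f x + g x)) (∑-distrib-+ xs f g)) (interchange (f x) (g x) _ _)
  where
  interchange : ∀ a b c d → (a + b) + (c + d) ≡ (a + c) + (b + d)
  interchange = solve-∀

∑-distrib-minus : ∀ (xs : List A) (f g : A → ℤ) → ∑[ x ∈ xs ] (f x - g x) ≡ ∑ xs f - ∑ xs g
∑-distrib-minus []       f g = refl
∑-distrib-minus (x ∷ xs) f g =
  trans (cong (_+_ (f x - g x)) (∑-distrib-minus xs f g)) (interchange (f x) (g x) _ _)
  where
  interchange : ∀ a b c d → (a - b) + (c - d) ≡ (a + c) - (b + d)
  interchange = solve-∀

𝟙 : {P : Pred A ℓ} → Decidable P → A → ℤ
𝟙 P? x = if does (P? x) then 1ℤ else 0ℤ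

length-filter≡∑𝟙 : ∀ {P : Pred A ℓ} (P? : Decidable P) (xs : List A) →
                   + length (filter P? xs) ≡ ∑ xs (𝟙 P?)
length-filter≡∑𝟙 P? []       = refl
length-filter≡∑𝟙 P? (x ∷ xs) with does (P? x)
... | true  = cong (_+_ 1ℤ) (length-filter≡∑𝟙 P? xs)
... | false = trans (length-filter≡∑𝟙 P? xs) (sym (+-identityˡ _))

∑-allSeqs-∷ : ∀ n (f : Vec Bool (suc n) → ℤ) →
              ∑ (allSeqs (suc n)) f ≡ ∑[ x ∈ allSeqs n ] f (true ∷ x) + ∑[ x ∈ allSeqs n ] f (false ∷ x)
∑-allSeqs-∷ n f = trans (∑-++ (map (true ∷_) (allSeqs n)) _ f)
                        (cong₂ _+_ (∑-map _ (allSeqs n) f) (∑-map _ (allSeqs n) f))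

∑-allSeqs-∷ʳ : ∀ n (f : Vec Bool (suc n) → ℤ) →
               ∑ (allSeqs (suc n)) f ≡ ∑[ x ∈ allSeqs n ] (f (x ∷ʳ true) + f (x ∷ʳ false))
∑-allSeqs-∷ʳ 0       f = assoc (f (true ∷ [])) (f (false ∷ []))
  where
  assoc : ∀ a b → a + (b + 0ℤ) ≡ (a + b) + 0ℤ
  assoc = solve-∀
∑-allSeqs-∷ʳ (suc n) f = begin
  ∑ (allSeqs (suc (suc n))) f
    ≡⟨ ∑-allSeqs-∷ (suc n) f ⟩
  ∑[ x ∈ allSeqs (suc n) ] f (true ∷ x) + ∑[ x ∈ allSeqs (suc n) ] f (false ∷ x)
    ≡⟨ cong₂ _+_ (∑-allSeqs-∷ʳ n (λ x → f (true ∷ x))) (∑-allSeqs-∷ʳ n (λ x → f (false ∷ x))) ⟩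
  ∑[ x ∈ allSeqs n ] (f (true ∷ (x ∷ʳ true)) + f (true ∷ (x ∷ʳ false)))
    + ∑[ x ∈ allSeqs n ] (f (false ∷ (x ∷ʳ true)) + f (false ∷ (x ∷ʳ false)))
    ≡⟨ ∑-allSeqs-∷ n (λ x → f (x ∷ʳ true) + f (x ∷ʳ false)) ⟨
  ∑[ x ∈ allSeqs (suc n) ] (f (x ∷ʳ true) + f (x ∷ʳ false))
    ∎
  where open ≡-Reasoning

S-∷ʳ : ∀ {n} (x : Vec Bool (suc n)) b → S (x ∷ʳ b) ≡ S x + pairScore (last x) b
S-∷ʳ (a ∷ [])     b = trans (+-identityʳ (pairScore a b)) (sym (+-identityˡ (pairScore a b)))
S-∷ʳ (a ∷ y ∷ xs) b =
  trans (cong (_+_ (pairScore a y)) (S-∷ʳ (y ∷ xs) b)) (sym (+-assoc (pairScore a y) _ _))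

negSignum : ℤ → ℤ
negSignum (+ 0)     = 0ℤ
negSignum (+ suc _) = -1ℤ
negSignum -[1+ _ ]  = 1ℤ

𝟙[<0]-𝟙[>0]≡negSignum : ∀ s → 𝟙 (_<?ᶻ 0ℤ) s - 𝟙 (0ℤ <?ᶻ_) s ≡ negSignum s
𝟙[<0]-𝟙[>0]≡negSignum (+ 0)     = refl
𝟙[<0]-𝟙[>0]≡negSignum (+ suc _) = refl
𝟙[<0]-𝟙[>0]≡negSignum -[1+ _ ]  = refl

D≡∑negSignum : ∀ n → D n ≡ ∑[ x ∈ allSeqs n ] negSignum (S x)
D≡∑negSignum n = begin
  D n
    ≡⟨ cong₂ _-_ (length-filter≡∑𝟙 (λ x → S x <?ᶻ 0ℤ) (allSeqs n))
                 (length-filter≡∑𝟙 (λ x → 0ℤ <?ᶻ S x) (allSeqs n)) ⟩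
  ∑[ x ∈ allSeqs n ] 𝟙 (_<?ᶻ 0ℤ) (S x) - ∑[ x ∈ allSeqs n ] 𝟙 (0ℤ <?ᶻ_) (S x)
    ≡⟨ ∑-distrib-minus (allSeqs n) _ _ ⟨
  ∑[ x ∈ allSeqs n ] (𝟙 (_<?ᶻ 0ℤ) (S x) - 𝟙 (0ℤ <?ᶻ_) (S x))
    ≡⟨ ∑-cong (allSeqs n) (λ x → 𝟙[<0]-𝟙[>0]≡negSignum (S x)) ⟩
  ∑[ x ∈ allSeqs n ] negSignum (S x)
    ∎
  where open ≡-Reasoning

negSignum-shift-±1 : ∀ s →
  negSignum (s + 1ℤ) + negSignum (s + -1ℤ)
    ≡ (negSignum s + negSignum s) + (𝟙 (_≟ᶻ 1ℤ) s - 𝟙 (_≟ᶻ -1ℤ) s)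
negSignum-shift-±1 (+ 0)             = refl
negSignum-shift-±1 (+ 1)             = refl
negSignum-shift-±1 (+ suc (suc _))   = refl
negSignum-shift-±1 -[1+ 0 ]          = refl
negSignum-shift-±1 -[1+ suc _ ]      = refl

endsIn1∧S≟ : ∀ {n} (k : ℤ) → Decidable (λ (x : Vec Bool (suc n)) → _)
endsIn1∧S≟ k x = (last x ≟ᵇ true) ×-dec (S x ≟ᶻ k)

negSignum-S-∷ʳ : ∀ {n} (x : Vec Bool (suc n)) →
  negSignum (S (x ∷ʳ true)) + negSignum (S (x ∷ʳ false))
    ≡ (negSignum (S x) + negSignum (S x)) + (𝟙 (endsIn1∧S≟ 1ℤ) x - 𝟙 (endsIn1∧S≟ -1ℤ) x)
negSignum-S-∷ʳ x rewrite S-∷ʳ x true | S-∷ʳ x false with last x | S x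
... | false | s rewrite +-identityʳ s = sym (+-identityʳ _)
... | true  | s = negSignum-shift-±1 s

D-suc : ∀ n → D (suc n) ≡ (D n + D n) + (+ h2 n - + h4 n)
D-suc 0       = refl
D-suc (suc n) = begin
  D (suc (suc n))
    ≡⟨ D≡∑negSignum (suc (suc n)) ⟩
  ∑[ x ∈ allSeqs (suc (suc n)) ] negSignum (S x)
    ≡⟨ ∑-allSeqs-∷ʳ (suc n) (λ x → negSignum (S x)) ⟩
  ∑[ x ∈ xs ] (negSignum (S (x ∷ʳ true)) + negSignum (S (x ∷ʳ false)))
    ≡⟨ ∑-cong xs negSignum-S-∷ʳ ⟩
  ∑[ x ∈ xs ] ((negSignum (S x) + negSignum (S x)) + (𝟙 h₂? x - 𝟙 h₄? x))
    ≡⟨ ∑-distrib-+ xs _ _ ⟩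
  ∑[ x ∈ xs ] (negSignum (S x) + negSignum (S x)) + ∑[ x ∈ xs ] (𝟙 h₂? x - 𝟙 h₄? x)
    ≡⟨ cong₂ _+_ (∑-distrib-+ xs _ _) (∑-distrib-minus xs _ _) ⟩
  (∑[ x ∈ xs ] negSignum (S x) + ∑[ x ∈ xs ] negSignum (S x)) + (∑ xs (𝟙 h₂?) - ∑ xs (𝟙 h₄?))
    ≡⟨ cong₂ _+_ (cong₂ _+_ (D≡∑negSignum (suc n)) (D≡∑negSignum (suc n)))
                 (cong₂ _-_ (length-filter≡∑𝟙 h₂? xs) (length-filter≡∑𝟙 h₄? xs)) ⟨
  (D (suc n) + D (suc n)) + (+ h2 (suc n) - + h4 (suc n))
    ∎
  where
  open ≡-Reasoning
  xs = allSeqs (suc n)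
  h₂? = endsIn1∧S≟ 1ℤ
  h₄? = endsIn1∧S≟ -1ℤ

lemma1 : (n : ℕ) → 2 ≤ n → D (suc n) - D n ≡ D n - (+ h4 n - + h2 n)
lemma1 n _ = trans (cong (_- D n) (D-suc n)) (rearrange (D n) (+ h2 n) (+ h4 n))
  where
  rearrange : ∀ d a b → ((d + d) + (a - b)) - d ≡ d - (b - a)
  rearrange = solve-∀
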